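{- Let $G$ be a $2$-edge-connected, unweighted, undirected graph and $T$ a spanning tree of $G$ rooted at a vertex $r$. For every vertex $x$, let $E(x)=\{(x,y)\in E(G)\setminus E(T) : x\notin\mathcal{A}(y)\}$. Fix a tree edge $e=(p(v),v)$ and let $X$ be the vertex set of the subtree of $T$ rooted at $v$. For each $x\in X$ let $F(x,e)=E(x)\cap S(e)$ and choose $f_x\in\arg\min_{f\in F(x,e)}\sigma_{G-e}(T_{e/f})$ (with the convention that if $F(x,e)=\emptyset$ then $f_x=\perp$ and $\sigma_{G-e}(T_{e/f_x})=+\infty$). If $f^*\in\arg\min_{f_x:\,x\in X}\sigma_{G-e}(T_{e/f_x})$, then $f^*$ is a best swap edge of $e$, i.e. $f^*\in\arg\min_{f\in S(e)}\sigma_{G-e}(T_{e/f})$.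
   Context: $\mathcal{A}(y)$ denotes the set of proper ancestors of $y$ in the rooted tree $T$, and $p(v)$ is the parent of $v$. Distances $d_H$ count edges on shortest paths. The stretch factor of a spanning tree $T'$ of a graph $H$ is $\sigma_H(T')=\max_{x,y} d_{T'}(x,y)/d_H(x,y)$. For $e\in E(T)$, $G-e$ is $G$ without $e$; $S(e)$ is the set of edges of $E(G)\setminus\{e\}$ whose endpoints lie in different components of $T-e$; for $f\in S(e)$, $T_{e/f}$ is $T$ with $e$ replaced by $f$. A best swap edge for $e$ is an element of $\arg\min_{f\in S(e)}\sigma_{G-e}(T_{e/f})$. An edge $(x,y)$ in $E(x)$ is regarded as incident to $x$ (an edge may belong to both $E(x)$ and $E(y)$). -}

module Defs where

open import Data.Nat as ℕ using (ℕ; zero; suc; _+_; _∸_)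
open import Data.Fin using (Fin; _≟_)
open import Data.Bool using (Bool; true; false; _∧_; _∨_; not; if_then_else_)
open import Data.List using (List; []; _∷_; allFin; concatMap; foldr)
open import Data.Bool.ListAction using (any)
open import Data.Product using (_×_; _,_; Σ; ∃)
open import Data.Sum using (_⊎_)
open import Data.Maybe using (Maybe; just; nothing)
open import Data.Unit using (⊤)
open import Data.Empty using (⊥)
open import Data.Integer using (+_)
open import Data.Rational using (ℚ; _/_; _⊔_; 0ℚ) renaming (_≤_ to _≤ℚ_)
open import Relation.Nullary using (¬_; ⌊_⌋)
open import Relation.Binary.PropositionalEquality using (_≡_; _≢_)

-- A (simple, undirected, unweighted) graph on vertex set Fin n, given by a
-- Boolean adjacency relation (symmetric, irreflexive: see SimpleGraph).
Graph : ℕ → Set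
Graph n = Fin n → Fin n → Bool

-- An edge is written as an (ordered) pair of endpoints; (x , y) is the edge
-- {x,y}, "regarded as incident to x".
Edge : ℕ → Set
Edge n = Fin n × Fin n

SimpleGraph : ∀ {n} → Graph n → Set
SimpleGraph {n} G = (∀ x y → G x y ≡ G y x) × (∀ x → G x x ≡ false)

sameEdge : ∀ {n} → Edge n → Edge n → Bool
sameEdge (a , b) (x , y) =
  (⌊ a ≟ x ⌋ ∧ ⌊ b ≟ y ⌋) ∨ (⌊ a ≟ y ⌋ ∧ ⌊ b ≟ x ⌋)

removeE : ∀ {n} → Graph n → Edge n → Graph n
removeE A e x y = A x y ∧ not (sameEdge e (x , y))

addE : ∀ {n} → Graph n → Edge n → Graph n
addE A f x y = A x y ∨ sameEdge f (x , y)

swap : ∀ {n} → Graph n → Edge n → Edge n → Graph n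
swap T e f = addE (removeE T e) f

ball : ∀ {n} → Graph n → ℕ → Fin n → Fin n → Bool
ball A zero u w = ⌊ u ≟ w ⌋
ball {n} A (suc k) u w = ball A k u w ∨ any (λ z → ball A k u z ∧ A z w) (allFin n)

reach : ∀ {n} → Graph n → Fin n → Fin n → Bool
reach {n} A u w = ball A n u w

Connected : ∀ {n} → Graph n → Set
Connected A = ∀ u w → reach A u w ≡ true

-- d_A(u,w): least k with a walk of length ≤ k (i.e. shortest path length,
-- counted in edges); returns n if w is unreachable (never used here).
findDist : ∀ {n} → Graph n → Fin n → Fin n → ℕ → ℕ → ℕ
findDist A u w k zero = k
findDist A u w k (suc fuel) = if ball A k u w then k else findDist A u w (suc k) fuel

dist : ∀ {n} → Graph n → Fin n → Fin n → ℕ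
dist {n} A u w = findDist A u w 0 n

-- ratio d_T'(x,y) / d_H(x,y) (denominator ≥ 1 for x ≠ y in connected H)
ratio : ∀ {n} → Graph n → Graph n → Fin n → Fin n → ℚ
ratio H T' x y = (+ dist T' x y) / suc (dist H x y ∸ 1)

stretch : ∀ {n} → Graph n → Graph n → ℚ
stretch {n} H T' =
  foldr _⊔_ 0ℚ
    (concatMap (λ x → concatMap (λ y →
        if ⌊ x ≟ y ⌋ then [] else ratio H T' x y ∷ []) (allFin n)) (allFin n))

TwoEdgeConnected : ∀ {n} → Graph n → Set
TwoEdgeConnected G =
  Connected G × (∀ a b → G a b ≡ true → Connected (removeE G (a , b)))

SpanningTree : ∀ {n} → Graph n → Graph n → Set
SpanningTree G T =
  (∀ x y → T x y ≡ true → G x y ≡ true) ×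
  (∀ x y → T x y ≡ T y x) ×
  Connected T ×
  (∀ a b → T a b ≡ true → reach (removeE T (a , b)) a b ≡ false)

-- u ∈ 𝒜(y): u is a proper ancestor of y in T rooted at r, i.e. u ≠ y and u
-- lies on the (unique) tree path from r to y.
Anc : ∀ {n} → Graph n → Fin n → Fin n → Fin n → Set
Anc T r u y = u ≢ y × dist T r y ≡ dist T r u + dist T u y

InSubtree : ∀ {n} → Graph n → Fin n → Fin n → Fin n → Set
InSubtree T r v w = w ≡ v ⊎ Anc T r v w

InS : ∀ {n} → Graph n → Graph n → Edge n → Edge n → Set
InS G T e (a , b) =
  G a b ≡ true × sameEdge e (a , b) ≡ false × reach (removeE T e) a b ≡ false

InEx : ∀ {n} → Graph n → Graph n → Fin n → Fin n → Edge n → Set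
InEx G T r x (a , b) = a ≡ x × G a b ≡ true × T a b ≡ false × ¬ Anc T r a b

InF : ∀ {n} → Graph n → Graph n → Fin n → Edge n → Fin n → Edge n → Set
InF G T r e x f = InEx G T r x f × InS G T e f

cost : ∀ {n} → Graph n → Graph n → Edge n → Edge n → ℚ
cost G T e f = stretch (removeE G e) (swap T e f)

ArgMin : ∀ {n} → Graph n → Graph n → Edge n → (Edge n → Set) → Edge n → Set
ArgMin G T e P f = P f × (∀ g → P g → cost G T e f ≤ℚ cost G T e g)

-- value with the convention σ(T_{e/⊥}) = +∞ (nothing = +∞)
val : ∀ {n} → Graph n → Graph n → Edge n → Maybe (Edge n) → Maybe ℚ
val G T e nothing = nothing
val G T e (just f) = just (cost G T e f)

_≤∞_ : Maybe ℚ → Maybe ℚ → Set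
_ ≤∞ nothing = ⊤
nothing ≤∞ just _ = ⊥
just p ≤∞ just q = p ≤ℚ q

ValidChoice : ∀ {n} → Graph n → Graph n → Fin n → Edge n → Fin n → Maybe (Edge n) → Set
ValidChoice G T r e x m =
  (m ≡ nothing × (∀ g → ¬ InF G T r e x g)) ⊎
  (Σ _ λ f → m ≡ just f × ArgMin G T e (InF G T r e x) f)

-- Let e = (pv , v) be a tree edge and let V be the set of vertices reachable
-- from v in T - e.  The proof rests on two facts about this cut.
--
--  (1) V is exactly the vertex set X of the subtree rooted at v.  Both
--      inclusions compare the tree distance from the root along a shortest
--      tree walk with the first place where that walk uses the edge e.
--  (2) Every swap edge f ∈ S(e) has exactly one endpoint a in V; oriented
--      away from a, it belongs to F(a , e) (it is a non-tree edge, and a is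
--      not an ancestor of the other endpoint, which lies outside X = V).
--      Orientation does not change T_{e/f}, hence not the cost.
--
-- So min over S(e) equals min over x ∈ X of min over F(x , e); moreover F is
-- nonempty for some x because G - e is connected, so f* is not ⊥.

module Submission where

open import Defs
open import Data.Nat using (ℕ; zero; suc; _+_; _∸_; _≤_; z≤n; s≤s; s≤s⁻¹; _≤?_)
open import Data.Nat.Properties hiding (_≟_)
open import Data.Fin using (Fin; _≟_)
open import Data.Bool using (Bool; true; false; _∧_; _∨_; not; if_then_else_)
open import Data.Bool.Properties using (∨-comm; ∧-comm)
open import Data.Bool.ListAction using (any)
open import Data.List using (List; []; _∷_; allFin; length; foldr; concat)
open import Data.List.Properties using (map-cong; length-tabulate)
open import Data.List.Membership.Propositional using (_∈_)
open import Data.List.Membership.Propositional.Properties using (∈-allFin)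
open import Data.List.Relation.Unary.Any using (here; there)
open import Data.Product using (_×_; _,_; Σ; proj₁; proj₂) renaming (swap to reverse)
open import Data.Sum using (_⊎_; inj₁; inj₂)
open import Data.Empty using (⊥; ⊥-elim)
open import Data.Maybe using (Maybe; just; nothing)
import Data.Integer as ℤ
open import Data.Rational using (_/_; _⊔_; 0ℚ) renaming (_≤_ to _≤ℚ_)
open import Data.Rational.Properties using () renaming (≤-trans to ≤ℚ-trans)
open import Relation.Nullary using (¬_; Dec; yes; no; ⌊_⌋)
open import Relation.Binary.PropositionalEquality

∨-introˡ : ∀ {a b} → a ≡ true → a ∨ b ≡ true
∨-introˡ refl = refl

∨-introʳ : ∀ {a b} → b ≡ true → a ∨ b ≡ true
∨-introʳ {true}  _   = refl
∨-introʳ {false} b≡t = b≡t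

∨-elim : ∀ {a b} → a ∨ b ≡ true → a ≡ true ⊎ b ≡ true
∨-elim {true}  _   = inj₁ refl
∨-elim {false} b≡t = inj₂ b≡t

∧-intro : ∀ {a b} → a ≡ true → b ≡ true → a ∧ b ≡ true
∧-intro refl b≡t = b≡t

∧-elim : ∀ {a b} → a ∧ b ≡ true → a ≡ true × b ≡ true
∧-elim {true}  b≡t = refl , b≡t
∧-elim {false} ()

isYes-sound : ∀ {P : Set} (d : Dec P) → ⌊ d ⌋ ≡ true → P
isYes-sound (yes p) _ = p

isYes-complete : ∀ {P : Set} (d : Dec P) → P → ⌊ d ⌋ ≡ true
isYes-complete (yes _) _ = refl
isYes-complete (no ¬p) p = ⊥-elim (¬p p)

any-intro : ∀ {A : Set} (p : A → Bool) {x} xs → x ∈ xs → p x ≡ true → any p xs ≡ true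
any-intro p (y ∷ xs) (here refl) px = ∨-introˡ px
any-intro p (y ∷ xs) (there x∈xs) px = ∨-introʳ (any-intro p xs x∈xs px)

any-elim : ∀ {A : Set} (p : A → Bool) xs → any p xs ≡ true → Σ A λ x → p x ≡ true
any-elim p (y ∷ xs) any≡t with ∨-elim {p y} any≡t
... | inj₁ py = y , py
... | inj₂ rest = any-elim p xs rest

-- Counting the entries of a list satisfying a Boolean predicate; used for
-- the pigeonhole argument behind saturation of balls.

count : ∀ {A : Set} → (A → Bool) → List A → ℕ
count p [] = 0
count p (x ∷ xs) = (if p x then 1 else 0) + count p xs

Implies : ∀ {A : Set} → (A → Bool) → (A → Bool) → Set
Implies p q = ∀ x → p x ≡ true → q x ≡ true

count≤length : ∀ {A : Set} (p : A → Bool) xs → count p xs ≤ length xs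
count≤length p [] = z≤n
count≤length p (x ∷ xs) with p x
... | true  = s≤s (count≤length p xs)
... | false = m≤n⇒m≤1+n (count≤length p xs)

count-pos : ∀ {A : Set} {p : A → Bool} {x} xs → x ∈ xs → p x ≡ true → 1 ≤ count p xs
count-pos {p = p} (y ∷ xs) (here refl) px rewrite px = s≤s z≤n
count-pos {p = p} (y ∷ xs) (there x∈xs) px =
  ≤-trans (count-pos xs x∈xs px) (m≤n+m (count p xs) (if p y then 1 else 0))

count-mono : ∀ {A : Set} {p q : A → Bool} → Implies p q → ∀ xs → count p xs ≤ count q xs
count-mono p⇒q [] = z≤n
count-mono {p = p} {q} p⇒q (y ∷ xs) with p y in py | q y in qy
... | true  | true  = s≤s (count-mono p⇒q xs)
... | false | true  = m≤n⇒m≤1+n (count-mono p⇒q xs)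
... | false | false = count-mono p⇒q xs
... | true  | false with () ← trans (sym qy) (p⇒q y py)

-- If p implies q and q has no more witnesses than p in xs, then q implies p
-- on xs: a strict inclusion would strictly increase the count.
count-reflect : ∀ {A : Set} {p q : A → Bool} → Implies p q →
                ∀ xs → count q xs ≤ count p xs → ∀ {x} → x ∈ xs → q x ≡ true → p x ≡ true
count-reflect {p = p} {q} p⇒q (y ∷ xs) le x∈ qx with p y in py | q y in qy
... | true  | false with () ← trans (sym qy) (p⇒q y py)
... | false | true  = ⊥-elim (<-irrefl refl (≤-trans le (count-mono p⇒q xs)))
... | true  | true  with x∈
...   | here refl    = py
...   | there x∈xs   = count-reflect p⇒q xs (s≤s⁻¹ le) x∈xs qx
count-reflect p⇒q (y ∷ xs) le x∈ qx | false | false with x∈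
...   | here refl with () ← trans (sym qy) qx
...   | there x∈xs   = count-reflect p⇒q xs le x∈xs qx

module _ {n : ℕ} where

  SymmetricGraph : Graph n → Set
  SymmetricGraph A = ∀ x y → A x y ≡ A y x

  Subgraph : Graph n → Graph n → Set
  Subgraph A A' = ∀ x y → A x y ≡ true → A' x y ≡ true

  -- Walk A k u w : a walk from u to w in A of length at most k.
  infixl 5 _▷_
  data Walk (A : Graph n) : ℕ → Fin n → Fin n → Set where
    stay : ∀ {k u} → Walk A k u u
    _▷_  : ∀ {k u z w} → Walk A k u z → A z w ≡ true → Walk A (suc k) u w

  module _ {A : Graph n} where

    walk-mono : ∀ {k k' u w} → k ≤ k' → Walk A k u w → Walk A k' u w
    walk-mono _ stay = stay
    walk-mono (s≤s k≤k') (p ▷ a) = walk-mono k≤k' p ▷ a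

    walk-weaken : ∀ {k u w} → Walk A k u w → Walk A (suc k) u w
    walk-weaken {k} = walk-mono (n≤1+n k)

    infixr 4 _++_
    _++_ : ∀ {k l u m w} → Walk A k u m → Walk A l m w → Walk A (l + k) u w
    p ++ stay = walk-mono (m≤n+m _ _) p
    p ++ (q ▷ a) = (p ++ q) ▷ a

    walk-prepend : ∀ {k u z w} → A u z ≡ true → Walk A k z w → Walk A (suc k) u w
    walk-prepend a stay = stay ▷ a
    walk-prepend a (p ▷ b) = walk-prepend a p ▷ b

    walk-reverse : SymmetricGraph A → ∀ {k u w} → Walk A k u w → Walk A k w u
    walk-reverse sym-A stay = stay
    walk-reverse sym-A {w = w} (_▷_ {z = z} p a) =
      walk-prepend (trans (sym-A w z) a) (walk-reverse sym-A p)

    walk-map : ∀ {A' k u w} → Subgraph A A' → Walk A k u w → Walk A' k u w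
    walk-map A⊆A' stay = stay
    walk-map A⊆A' (p ▷ a) = walk-map A⊆A' p ▷ A⊆A' _ _ a

    walk-leaves : (P : Fin n → Bool) → ∀ {k u w} → Walk A k u w →
                  P u ≡ true → P w ≡ false →
                  Σ (Fin n) λ a → Σ (Fin n) λ b → P a ≡ true × P b ≡ false × A a b ≡ true
    walk-leaves P stay Pu Pw with () ← trans (sym Pu) Pw
    walk-leaves P (_▷_ {z = z} p a) Pu Pw with P z in Pz
    ... | true  = z , _ , Pz , Pw , a
    ... | false = walk-leaves P p Pu Pz

    ball-refl : ∀ k u → ball A k u u ≡ true
    ball-refl zero u = isYes-complete (u ≟ u) refl
    ball-refl (suc k) u = ∨-introˡ (ball-refl k u)

    walk⇒ball : ∀ {k u w} → Walk A k u w → ball A k u w ≡ true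
    walk⇒ball {k} {u} stay = ball-refl k u
    walk⇒ball {suc k} {u} {w} (_▷_ {z = z} p a) =
      ∨-introʳ (any-intro (λ y → ball A k u y ∧ A y w) (allFin n) (∈-allFin z)
                          (∧-intro (walk⇒ball p) a))

    ball⇒walk : ∀ k {u w} → ball A k u w ≡ true → Walk A k u w
    ball⇒walk zero {u} {w} b with refl ← isYes-sound (u ≟ w) b = stay
    ball⇒walk (suc k) {u} {w} b with ∨-elim {ball A k u w} b
    ... | inj₁ b' = walk-weaken (ball⇒walk k b')
    ... | inj₂ step with any-elim (λ y → ball A k u y ∧ A y w) (allFin n) step
    ...   | z , bz∧a = ball⇒walk k (proj₁ (∧-elim bz∧a)) ▷ proj₂ (∧-elim bz∧a)

  -- Saturation: the balls around u stop growing after at most n steps, so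
  -- any walk can be replaced by one of length at most n.
  module Saturation (A : Graph n) (u : Fin n) where

    Stable : ℕ → Set
    Stable k = ∀ {w} → Walk A (suc k) u w → Walk A k u w

    stable-shorten : ∀ {k l w} → Stable k → Walk A l u w → Walk A k u w
    stable-shorten st stay = stay
    stable-shorten st (p ▷ a) = st (stable-shorten st p ▷ a)

    ball-grows : ∀ k → Implies (ball A k u) (ball A (suc k) u)
    ball-grows k w = ∨-introˡ

    -- Up to radius j the balls either became stable or kept growing, in
    -- which case the ball of radius j has at least j + 1 elements.
    stable-or-growing : ∀ j → (Σ ℕ λ i → i ≤ j × Stable i) ⊎ (suc j ≤ count (ball A j u) (allFin n))
    stable-or-growing zero = inj₂ (count-pos (allFin n) (∈-allFin u) (ball-refl {A} 0 u))
    stable-or-growing (suc j) with stable-or-growing j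
    ... | inj₁ (i , i≤j , st) = inj₁ (i , m≤n⇒m≤1+n i≤j , st)
    ... | inj₂ big with count (ball A (suc j) u) (allFin n) ≤? count (ball A j u) (allFin n)
    ...   | yes same = inj₁ (j , n≤1+n j , λ p →
              ball⇒walk j (count-reflect (ball-grows j) (allFin n) same (∈-allFin _) (walk⇒ball p)))
    ...   | no  grew = inj₂ (≤-trans (s≤s big) (≰⇒> grew))

    -- There are only n vertices, so stability occurs by radius n.
    stable-within-n : Σ ℕ λ i → i ≤ n × Stable i
    stable-within-n with stable-or-growing n
    ... | inj₁ stable = stable
    ... | inj₂ big = ⊥-elim (<-irrefl refl (≤-trans big bounded))
      where
        bounded : count (ball A n u) (allFin n) ≤ n
        bounded = subst (count (ball A n u) (allFin n) ≤_) (length-tabulate {n = n} (λ x → x))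
                        (count≤length (ball A n u) (allFin n))

    saturate : ∀ {k w} → Walk A k u w → Walk A n u w
    saturate p with stable-within-n
    ... | i , i≤n , st = walk-mono i≤n (stable-shorten st p)

  -- Reachable A u w : a walk of length at most n joins u to w; by
  -- saturation this is the same as being joined by any walk.
  Reachable : Graph n → Fin n → Fin n → Set
  Reachable A u w = Walk A n u w

  reachable : ∀ {A k u w} → Walk A k u w → Reachable A u w
  reachable {A} {u = u} = Saturation.saturate A u

  reachable⇒reach : ∀ {A u w} → Reachable A u w → reach A u w ≡ true
  reachable⇒reach = walk⇒ball

  reach⇒reachable : ∀ {A u w} → reach A u w ≡ true → Reachable A u w
  reach⇒reachable = ball⇒walk n

  unreachable : ∀ {A u w} → reach A u w ≡ false → ¬ Reachable A u w
  unreachable r≡f p with () ← trans (sym r≡f) (reachable⇒reach p)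

  not-reachable : ∀ {A u w} → ¬ Reachable A u w → reach A u w ≡ false
  not-reachable {A} {u} {w} ¬p with reach A u w in r
  ... | true  = ⊥-elim (¬p (reach⇒reachable r))
  ... | false = refl

  dist-walk : ∀ {A u w} → reach A u w ≡ true → Walk A (dist A u w) u w
  dist-walk {A} {u} {w} r = search n 0 (subst (λ j → Walk A j u w) (sym (+-identityʳ n)) (reach⇒reachable r))
    where
      search : ∀ fuel k → Walk A (fuel + k) u w → Walk A (findDist A u w k fuel) u w
      search zero k p = p
      search (suc fuel) k p with ball A k u w in b
      ... | true  = ball⇒walk k b
      ... | false = search fuel (suc k) (subst (λ j → Walk A j u w) (sym (+-suc fuel k)) p)

  dist-minimal : ∀ {A k u w} → Walk A k u w → dist A u w ≤ k
  dist-minimal {A} {k} {u} {w} p = search n 0 z≤n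
    where
      search : ∀ fuel j → j ≤ k → findDist A u w j fuel ≤ k
      search zero j j≤k = j≤k
      search (suc fuel) j j≤k with ball A j u w in b
      ... | true  = j≤k
      ... | false = search fuel (suc j) (≤∧≢⇒< j≤k j≢k)
        where
          j≢k : j ≢ k
          j≢k refl with () ← trans (sym b) (walk⇒ball p)

  ball-cong : ∀ {A A'} → (∀ x y → A x y ≡ A' x y) → ∀ k u w → ball A k u w ≡ ball A' k u w
  ball-cong A≡A' zero u w = refl
  ball-cong A≡A' (suc k) u w =
    cong₂ _∨_ (ball-cong A≡A' k u w)
      (cong (foldr _∨_ false)
        (map-cong (λ z → cong₂ _∧_ (ball-cong A≡A' k u z) (A≡A' z w)) (allFin n)))

  dist-cong : ∀ {A A'} → (∀ x y → A x y ≡ A' x y) → ∀ u w → dist A u w ≡ dist A' u w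
  dist-cong {A} {A'} A≡A' u w = search n 0
    where
      search : ∀ fuel k → findDist A u w k fuel ≡ findDist A' u w k fuel
      search zero k = refl
      search (suc fuel) k rewrite ball-cong A≡A' k u w with ball A' k u w
      ... | true  = refl
      ... | false = search fuel (suc k)

  stretch-cong : ∀ (H A A' : Graph n) → (∀ x y → A x y ≡ A' x y) → stretch H A ≡ stretch H A'
  stretch-cong H A A' A≡A' =
    cong (foldr _⊔_ 0ℚ) (cong concat (map-cong (λ x →
      cong concat (map-cong (λ y →
        cong (λ m → if ⌊ x ≟ y ⌋ then [] else ((ℤ.+ m) / suc (dist H x y ∸ 1)) ∷ [])
             (dist-cong A≡A' x y)) (allFin n))) (allFin n)))

  sameEdge-true : ∀ {a b x y : Fin n} → sameEdge (a , b) (x , y) ≡ true →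
                  (a ≡ x × b ≡ y) ⊎ (a ≡ y × b ≡ x)
  sameEdge-true {a} {b} {x} {y} same with ∨-elim {⌊ a ≟ x ⌋ ∧ ⌊ b ≟ y ⌋} same
  ... | inj₁ q = inj₁ (isYes-sound (a ≟ x) (proj₁ (∧-elim q)) , isYes-sound (b ≟ y) (proj₂ (∧-elim q)))
  ... | inj₂ q = inj₂ (isYes-sound (a ≟ y) (proj₁ (∧-elim q)) , isYes-sound (b ≟ x) (proj₂ (∧-elim q)))

  sameEdge-flipʳ : ∀ (e : Edge n) x y → sameEdge e (x , y) ≡ sameEdge e (y , x)
  sameEdge-flipʳ (a , b) x y = ∨-comm (⌊ a ≟ x ⌋ ∧ ⌊ b ≟ y ⌋) (⌊ a ≟ y ⌋ ∧ ⌊ b ≟ x ⌋)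

  sameEdge-flipˡ : ∀ (a b : Fin n) f → sameEdge (b , a) f ≡ sameEdge (a , b) f
  sameEdge-flipˡ a b (x , y) =
    trans (∨-comm (⌊ b ≟ x ⌋ ∧ ⌊ a ≟ y ⌋) (⌊ b ≟ y ⌋ ∧ ⌊ a ≟ x ⌋))
          (cong₂ _∨_ (∧-comm ⌊ b ≟ y ⌋ ⌊ a ≟ x ⌋) (∧-comm ⌊ b ≟ x ⌋ ⌊ a ≟ y ⌋))

  Reorientation : Edge n → Edge n → Set
  Reorientation g f = g ≡ f ⊎ g ≡ reverse f

  cost-reorient : ∀ (G T : Graph n) e {g f} → Reorientation g f → cost G T e g ≡ cost G T e f
  cost-reorient G T e (inj₁ refl) = refl
  cost-reorient G T e {f = a , b} (inj₂ refl) =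
    stretch-cong (removeE G e) _ _ (λ x y → cong (removeE T e x y ∨_) (sameEdge-flipˡ a b (x , y)))

  module _ {A : Graph n} (e : Edge n) where

    removeE-sym : SymmetricGraph A → SymmetricGraph (removeE A e)
    removeE-sym sym-A x y = cong₂ _∧_ (sym-A x y) (cong not (sameEdge-flipʳ e x y))

    removeE-sub : Subgraph (removeE A e) A
    removeE-sub x y a = proj₁ (∧-elim a)

    removeE-keep : ∀ {x y} → A x y ≡ true → sameEdge e (x , y) ≡ false → removeE A e x y ≡ true
    removeE-keep a e≢xy rewrite a | e≢xy = refl

    removeE-other : ∀ {x y} → removeE A e x y ≡ true → sameEdge e (x , y) ≡ false
    removeE-other {x} {y} a with sameEdge e (x , y) | proj₂ (∧-elim {A x y} a)
    ... | false | _ = refl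

  data Crossing (A : Graph n) (s t : Fin n) (k : ℕ) (x y : Fin n) : Set where
    avoids   : Walk (removeE A (s , t)) k x y → Crossing A s t k x y
    forward  : ∀ {k₁ k₂} → suc (k₁ + k₂) ≤ k →
               Walk (removeE A (s , t)) k₁ x s → Walk A k₂ t y → Crossing A s t k x y
    backward : ∀ {k₁ k₂} → suc (k₁ + k₂) ≤ k →
               Walk (removeE A (s , t)) k₁ x t → Walk A k₂ s y → Crossing A s t k x y

  extend-bound : ∀ {k₁ k₂ k} → suc (k₁ + k₂) ≤ k → suc (k₁ + suc k₂) ≤ suc k
  extend-bound {k₁} {k₂} {k} le = subst (_≤ suc k) (cong suc (sym (+-suc k₁ k₂))) (s≤s le)

  first-crossing : ∀ {A s t k x y} → Walk A k x y → Crossing A s t k x y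
  first-crossing stay = avoids stay
  first-crossing {A} {s} {t} (_▷_ {k = k} {z = z} {w = y} p a) with first-crossing {s = s} {t} p
  ... | forward  le q q' = forward  (extend-bound le) q (q' ▷ a)
  ... | backward le q q' = backward (extend-bound le) q (q' ▷ a)
  ... | avoids q with sameEdge (s , t) (z , y) in same
  ...   | false = avoids (q ▷ removeE-keep {A = A} (s , t) a same)
  ...   | true with sameEdge-true {s} {t} {z} {y} same
  ...     | inj₁ (refl , refl) = forward  (s≤s (≤-reflexive (+-identityʳ k))) q stay
  ...     | inj₂ (refl , refl) = backward (s≤s (≤-reflexive (+-identityʳ k))) q stay

module Cut {n : ℕ} (T : Graph n) (r v pv : Fin n)
  (T-sym : SymmetricGraph T) (T-connected : Connected T)
  (e-bridge : reach (removeE T (pv , v)) pv v ≡ false)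
  (e-in-T : T pv v ≡ true) (pv-parent : Anc T r pv v) where

  e : Edge n
  e = (pv , v)

  T-e : Graph n
  T-e = removeE T e

  T-e-sym : SymmetricGraph T-e
  T-e-sym = removeE-sym e T-sym

  T-e-keep : ∀ {x y} → T x y ≡ true → sameEdge e (x , y) ≡ false → T-e x y ≡ true
  T-e-keep = removeE-keep {A = T} e

  d : Fin n → Fin n → ℕ
  d = dist T

  OnVSide : Fin n → Set
  OnVSide x = Reachable T-e v x

  v-on-side : OnVSide v
  v-on-side = stay

  on-side-step : ∀ {k x y} → OnVSide x → Walk T-e k x y → OnVSide y
  on-side-step v~x p = reachable (v~x ++ p)

  walk-from-v : ∀ {k x} → Walk T-e k v x → OnVSide x
  walk-from-v = reachable

  walk-to-v : ∀ {k x} → Walk T-e k x v → OnVSide x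
  walk-to-v p = reachable (walk-reverse T-e-sym p)

  pv-off-side : ¬ OnVSide pv
  pv-off-side v~pv = unreachable e-bridge (walk-reverse T-e-sym v~pv)

  shortest : ∀ u w → Walk T (d u w) u w
  shortest u w = dist-walk (T-connected u w)

  triangle : ∀ u m w → d u w ≤ d u m + d m w
  triangle u m w = subst (d u w ≤_) (+-comm (d m w) (d u m)) (dist-minimal (shortest u m ++ shortest m w))

  dist-T-e : ∀ {k u w} → Walk T-e k u w → d u w ≤ k
  dist-T-e p = dist-minimal (walk-map (removeE-sub e) p)

  d-pv-v : d pv v ≡ 1
  d-pv-v = ≤-antisym (dist-minimal e-walk) positive
    where
      e-walk : Walk T 1 pv v
      e-walk = stay ▷ e-in-T

      positive : 1 ≤ d pv v
      positive with d pv v | shortest pv v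
      ... | zero  | stay = ⊥-elim (proj₁ pv-parent refl)
      ... | suc _ | _    = s≤s z≤n

  d-r-v : d r v ≡ suc (d r pv)
  d-r-v = trans (proj₂ pv-parent) (trans (cong (d r pv +_) d-pv-v) (+-comm (d r pv) 1))

  subtree-distance : ∀ {y} → InSubtree T r v y → d r y ≡ d r v + d v y
  subtree-distance (inj₁ refl) = sym (trans (cong (d r v +_) d-v-v) (+-identityʳ (d r v)))
    where
      empty-walk : Walk T 0 v v
      empty-walk = stay

      d-v-v : d v v ≡ 0
      d-v-v = n≤0⇒n≡0 (dist-minimal empty-walk)
  subtree-distance (inj₂ (_ , eq)) = eq

  distance-subtree : ∀ {y} → d r y ≡ d r v + d v y → InSubtree T r v y
  distance-subtree {y} eq with y ≟ v
  ... | yes y≡v = inj₁ y≡v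
  ... | no  y≢v = inj₂ ((λ v≡y → y≢v (sym v≡y)) , eq)

  -- The root is on pv's side: a shortest tree walk from r to pv cannot
  -- pass through v, which is farther from r than pv.
  root-off-side : ¬ OnVSide r
  root-off-side v~r with first-crossing {s = pv} {v} (shortest r pv)
  ... | avoids q        = pv-off-side (on-side-step v~r q)
  ... | forward _ q _   = pv-off-side (on-side-step v~r q)
  ... | backward {k₁} {k₂} le q _ = <-irrefl refl (begin-strict
        d r pv          <⟨ n<1+n _ ⟩
        suc (d r pv)    ≡⟨ sym d-r-v ⟩
        d r v           ≤⟨ dist-T-e q ⟩
        k₁              ≤⟨ m≤m+n k₁ k₂ ⟩
        k₁ + k₂         <⟨ le ⟩
        d r pv          ∎)
    where open ≤-Reasoning

  -- V ⊆ X: a shortest tree walk from r to a vertex on v's side must cross e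
  -- from pv to v, so it is at least as long as d r v + d v x.
  on-side⇒subtree : ∀ {x} → OnVSide x → InSubtree T r v x
  on-side⇒subtree {x} v~x = distance-subtree (≤-antisym (triangle r v x) through-e)
    where
      through-e : d r v + d v x ≤ d r x
      through-e with first-crossing {s = pv} {v} (shortest r x)
      ... | avoids q         = ⊥-elim (root-off-side (on-side-step v~x (walk-reverse T-e-sym q)))
      ... | backward _ q _   = ⊥-elim (root-off-side (walk-to-v q))
      ... | forward {k₁} {k₂} le q q' = begin
            d r v + d v x            ≡⟨ cong (_+ d v x) d-r-v ⟩
            suc (d r pv + d v x)     ≤⟨ s≤s (+-mono-≤ (dist-T-e q) (dist-minimal q')) ⟩
            suc (k₁ + k₂)            ≤⟨ le ⟩
            d r x                    ∎
        where open ≤-Reasoning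

  -- X ⊆ V: a shortest tree walk from v into its subtree never uses e, since
  -- going through pv would make the vertex closer to the root than it is.
  subtree⇒on-side : ∀ {x} → InSubtree T r v x → OnVSide x
  subtree⇒on-side (inj₁ refl) = v-on-side
  subtree⇒on-side {x} (inj₂ (_ , eq)) with first-crossing {s = pv} {v} (shortest v x)
  ... | avoids q        = walk-from-v q
  ... | forward _ q _   = ⊥-elim (pv-off-side (walk-from-v q))
  ... | backward {k₁} {k₂} le _ q' = ⊥-elim (<-irrefl refl (begin-strict
        d r x                    ≤⟨ triangle r pv x ⟩
        d r pv + d pv x          ≤⟨ +-monoʳ-≤ (d r pv) (≤-trans (dist-minimal q') (m≤n+m k₂ k₁)) ⟩
        d r pv + (k₁ + k₂)       <⟨ +-monoʳ-< (d r pv) le ⟩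
        d r pv + d v x           <⟨ n<1+n _ ⟩
        suc (d r pv) + d v x     ≡⟨ cong (_+ d v x) (sym d-r-v) ⟩
        d r v + d v x            ≡⟨ sym eq ⟩
        d r x                    ∎))
    where open ≤-Reasoning

  -- T - e has at most two components: those of v and of pv.
  two-sides : ∀ {k w} → Walk T k v w → OnVSide w ⊎ Reachable T-e pv w
  two-sides stay = inj₁ v-on-side
  two-sides (_▷_ {z = z} {w = w} p a) with sameEdge e (z , w) in same
  ... | false with two-sides p
  ...   | inj₁ v~z  = inj₁ (reachable (v~z ▷ T-e-keep a same))
  ...   | inj₂ pv~z = inj₂ (reachable (pv~z ▷ T-e-keep a same))
  two-sides (_▷_ {z = z} {w = w} p a) | true with sameEdge-true {a = pv} {v} {z} {w} same
  ...   | inj₁ (_ , refl) = inj₁ v-on-side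
  ...   | inj₂ (refl , _) = inj₂ stay

  side-of : ∀ w → OnVSide w ⊎ Reachable T-e pv w
  side-of w = two-sides (shortest v w)

module Candidates {n : ℕ} (G T : Graph n) (r v pv : Fin n)
  (G-sym : SymmetricGraph G) (G-e-connected : Connected (removeE G (pv , v)))
  (tree : SpanningTree G T) (e-in-T : T pv v ≡ true) (pv-parent : Anc T r pv v) where

  open Cut T r v pv (proj₁ (proj₂ tree)) (proj₁ (proj₂ (proj₂ tree)))
           (proj₂ (proj₂ (proj₂ tree)) pv v e-in-T) e-in-T pv-parent

  -- An edge of G - e leaving v's side is a candidate of its endpoint on
  -- v's side: it is not a tree edge, does not reconnect within T - e, and
  -- its inner endpoint is no ancestor of the outer one (that one would then
  -- lie in X = V).
  leaving-edge : ∀ {a b} → OnVSide a → ¬ OnVSide b → G a b ≡ true → sameEdge e (a , b) ≡ false →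
                 InSubtree T r v a × InF G T r e a (a , b)
  leaving-edge {a} {b} v~a b-off gab e≢ab =
    on-side⇒subtree v~a , (refl , gab , non-tree , not-ancestor) , (gab , e≢ab , not-reconnecting)
    where
      non-tree : T a b ≡ false
      non-tree with T a b in tab
      ... | true  = ⊥-elim (b-off (reachable (v~a ▷ T-e-keep tab e≢ab)))
      ... | false = refl

      not-reconnecting : reach T-e a b ≡ false
      not-reconnecting = not-reachable (λ a~b → b-off (on-side-step v~a a~b))

      not-ancestor : ¬ Anc T r a b
      not-ancestor (_ , eq) = b-off (subtree⇒on-side (distance-subtree (≤-antisym (triangle r v b) below)))
        where
          below : d r v + d v b ≤ d r b
          below = begin
            d r v + d v b             ≤⟨ +-monoʳ-≤ (d r v) (triangle v a b) ⟩
            d r v + (d v a + d a b)   ≡⟨ sym (+-assoc (d r v) (d v a) (d a b)) ⟩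
            d r v + d v a + d a b     ≡⟨ cong (_+ d a b) (sym (subtree-distance (on-side⇒subtree v~a))) ⟩
            d r a + d a b             ≡⟨ sym eq ⟩
            d r b                     ∎
            where open ≤-Reasoning

  cover : ∀ f → InS G T e f →
          Σ (Fin n) λ x → Σ (Edge n) λ g → (InSubtree T r v x × InF G T r e x g) × Reorientation g f
  cover (a , b) (gab , e≢ab , a≁b) with side-of a | side-of b
  ... | inj₁ v~a | _ = a , (a , b) , leaving-edge v~a b-off gab e≢ab , inj₁ refl
    where
      b-off : ¬ OnVSide b
      b-off v~b = unreachable a≁b (reachable (walk-reverse T-e-sym v~a ++ v~b))
  ... | inj₂ pv~a | inj₁ v~b =
        b , (b , a) , leaving-edge v~b a-off (trans (G-sym b a) gab) (trans (sym (sameEdge-flipʳ e a b)) e≢ab) ,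
        inj₂ refl
    where
      a-off : ¬ OnVSide a
      a-off v~a = pv-off-side (on-side-step v~a (walk-reverse T-e-sym pv~a))
  ... | inj₂ pv~a | inj₂ pv~b = ⊥-elim (unreachable a≁b (reachable (walk-reverse T-e-sym pv~a ++ pv~b)))

  -- Since G - e is connected, some edge of G - e leaves v's side.
  some-candidate : Σ (Fin n) λ x → Σ (Edge n) λ g → InSubtree T r v x × InF G T r e x g
  some-candidate with walk-leaves (reach T-e v) v⇝pv (reachable⇒reach v-on-side) (not-reachable pv-off-side)
    where
      v⇝pv : Reachable (removeE G e) v pv
      v⇝pv = reach⇒reachable (G-e-connected v pv)
  ... | a , b , v~a , v≁b , gab' =
        a , (a , b) , leaving-edge (reach⇒reachable v~a) (unreachable v≁b)
                                   (removeE-sub {A = G} e a b gab') (removeE-other {A = G} e gab')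

≤∞-trans : ∀ a b c → a ≤∞ b → b ≤∞ c → a ≤∞ c
≤∞-trans a b nothing _ _ = _
≤∞-trans (just p) (just q) (just s) p≤q q≤s = ≤ℚ-trans p≤q q≤s

module Selection {n : ℕ} (G T : Graph n) (r : Fin n) (e : Edge n) (X : Fin n → Set)
  (fsel : Fin n → Maybe (Edge n)) (valid : ∀ x → X x → ValidChoice G T r e x (fsel x)) where

  Candidate : Fin n → Edge n → Set
  Candidate x g = X x × InF G T r e x g

  choice-minimal : ∀ {x m g} → ValidChoice G T r e x m → InF G T r e x g → val G T e m ≤∞ just (cost G T e g)
  choice-minimal (inj₁ (_ , empty)) g∈F = ⊥-elim (empty _ g∈F)
  choice-minimal (inj₂ (_ , refl , _ , least)) g∈F = least _ g∈F

  choice-swap : ∀ {x f} → ValidChoice G T r e x (just f) → InS G T e f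
  choice-swap (inj₂ (_ , refl , (_ , f∈S) , _)) = f∈S

  below-candidates : ∀ m → (∀ x → X x → val G T e m ≤∞ val G T e (fsel x)) →
                     ∀ {x g} → Candidate x g → val G T e m ≤∞ just (cost G T e g)
  below-candidates m m-min {x} (x∈X , g∈F) =
    ≤∞-trans (val G T e m) (val G T e (fsel x)) (just _) (m-min x x∈X) (choice-minimal (valid x x∈X) g∈F)

  -- If some candidate exists and the candidates cover S(e) up to
  -- orientation, then the best of the choices f_x is a best swap edge:
  -- it beats every candidate, so it is not ⊥, and through the cover it
  -- beats every swap edge.
  best-of-choices :
    (Σ (Fin n) λ x → Σ (Edge n) λ g → Candidate x g) →
    (∀ f → InS G T e f → Σ (Fin n) λ x → Σ (Edge n) λ g → Candidate x g × Reorientation g f) →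
    (fstar : Maybe (Edge n)) →
    (Σ (Fin n) λ x → X x × fstar ≡ fsel x) →
    (∀ x → X x → val G T e fstar ≤∞ val G T e (fsel x)) →
    Σ (Edge n) λ f → fstar ≡ just f × ArgMin G T e (InS G T e) f
  best-of-choices (_ , _ , c) _ nothing _ fstar-min = ⊥-elim (below-candidates nothing fstar-min c)
  best-of-choices _ cover (just f) (x₀ , x₀∈X , f≡fx₀) fstar-min =
    f , refl , choice-swap (subst (ValidChoice G T r e x₀) (sym f≡fx₀) (valid x₀ x₀∈X)) , beats
    where
      beats : ∀ g → InS G T e g → cost G T e f ≤ℚ cost G T e g
      beats g g∈S = let (_ , _ , c , g'~g) = cover g g∈S in
        subst (cost G T e f ≤ℚ_) (cost-reorient G T e g'~g) (below-candidates (just f) fstar-min c)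

lemma1 : ∀ {n} (G T : Graph n) (r v pv : Fin n) →
    SimpleGraph G → TwoEdgeConnected G → SpanningTree G T →
    v ≢ r → T pv v ≡ true → Anc T r pv v →
    (fsel : Fin n → Maybe (Edge n)) →
    (∀ x → InSubtree T r v x → ValidChoice G T r (pv , v) x (fsel x)) →
    (fstar : Maybe (Edge n)) →
    (Σ (Fin n) λ x → InSubtree T r v x × fstar ≡ fsel x) →
    (∀ x → InSubtree T r v x → val G T (pv , v) fstar ≤∞ val G T (pv , v) (fsel x)) →
    Σ (Edge n) λ f → fstar ≡ just f × ArgMin G T (pv , v) (InS G T (pv , v)) f
lemma1 G T r v pv (G-sym , _) (_ , G-minus-connected) tree _ e-in-T pv-parent fsel valid =
  best-of-choices some-candidate cover
  where
    open Candidates G T r v pv G-sym (G-minus-connected pv v (proj₁ tree pv v e-in-T)) tree e-in-T pv-parent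
      using (some-candidate; cover)
    open Selection G T r (pv , v) (InSubtree T r v) fsel valid
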